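{- Let $A$ be an $n\times m$ array with $n\ge m$. The modified two-dimensional segment tree described in the context uses $O(nm)$ space, and each range update (add a constant $c$ to all entries of a sub-array $A[x_1:x_2,y_1:y_2]$) and each range sum query (return $\sum_{x=x_1}^{x_2}\sum_{y=y_1}^{y_2}A[x,y]$) is performed in $O(\log n\cdot\log m)=O(\log^2 n)$ time.
   Context: Data structure: an outer segment tree over $[1:n]$ (root covers $[1:n]$; a node covering $[x_1:x_2]$, $x_1<x_2$, has children covering $[x_1:x_{mid}]$ and $[x_{mid}+1:x_2]$ with $x_{mid}=\lfloor(x_1+x_2)/2\rfloor$), each outer node containing an inner segment tree over $[1:m]$ built the same way; each inner node stores global.value, global.lazy, local.value, local.lazy. Update of $[x_s:x_e,y_s:y_e]$ by $c$: descend the outer tree; at outer nodes whose range lies inside $[x_s:x_e]$ do an inner range update of global fields with $c$ and stop; at disjoint nodes stop; at partially overlapping nodes recurse into both children and also do an inner range update of local fields with the scaled value $c\cdot\frac{\min(x_e,x_2)-\max(x_s,x_1)+1}{x_2-x_1+1}$. Inner range updates are standard lazy-propagation range-add updates on the inner tree (adding value$\cdot$(region size) to the node value and value to its lazy at fully covered nodes, recomputing value $=$ children values $+$ lazy$\cdot$size on backtracking). Query: descend the outer tree; at outer nodes inside $[x_s:x_e]$ return a complete inner query (using local and global values and lazies); at disjoint nodes return 0; at partially overlapping nodes return a partial inner query (using only global values, scaled by $\frac{\min(x_e,x_2)-\max(x_s,x_1)+1}{x_2-x_1+1}$, and global lazies multiplied by the size of the trimmed query region) plus the results of both children. -}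

module Defs where

open import Data.Bool using (Bool; true; false; if_then_else_; _∧_; _∨_)
open import Data.Nat as ℕ using (ℕ; zero; suc; _∸_; _⊓_; _⊔_; _≤ᵇ_; _<ᵇ_; ⌊_/2⌋)
open import Data.Integer using (+_)
open import Data.Rational using (ℚ; 0ℚ; 1ℚ; _+_; _*_; _/_)
open import Data.Product using (_×_; _,_; proj₁; proj₂)

-- Ranges [lo:hi] of integer indices (ℕ, 1-based as in the paper)

mid : ℕ → ℕ → ℕ
mid lo hi = ⌊ lo ℕ.+ hi /2⌋

insideᵇ : (a b lo hi : ℕ) → Bool
insideᵇ a b lo hi = (a ≤ᵇ lo) ∧ (hi ≤ᵇ b)

disjointᵇ : (a b lo hi : ℕ) → Bool
disjointᵇ a b lo hi = (b <ᵇ lo) ∨ (hi <ᵇ a)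

common : (a b lo hi : ℕ) → ℕ
common a b lo hi = suc (hi ⊓ b) ∸ (lo ⊔ a)

toℚ : ℕ → ℚ
toℚ k = + k / 1

sizeℚ : ℕ → ℕ → ℚ
sizeℚ lo hi = toℚ (suc hi ∸ lo)

ratio : (a b lo hi : ℕ) → ℚ
ratio a b lo hi = + common a b lo hi / suc (hi ∸ lo)

record Fields : Set where
  constructor mkF
  field
    value : ℚ
    lazy  : ℚ
open Fields public

record INode : Set where
  constructor mkN
  field
    global : Fields
    local  : Fields
open INode public

zeroF : Fields
zeroF = mkF 0ℚ 0ℚ

zeroN : INode
zeroN = mkN zeroF zeroF

data Which : Set where
  glob loc : Which

getF : Which → INode → Fields
getF glob nd = global nd
getF loc  nd = local nd

setF : Which → Fields → INode → INode
setF glob f nd = mkN f (local nd)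
setF loc  f nd = mkN (global nd) f

data ITree : Set where
  ileaf : INode → ITree
  inode : INode → ITree → ITree → ITree

data OTree : Set where
  oleaf : ITree → OTree
  onode : ITree → OTree → OTree → OTree

rootI : ITree → INode
rootI (ileaf nd) = nd
rootI (inode nd _ _) = nd

innerOf : OTree → ITree
innerOf (oleaf it) = it
innerOf (onode it _ _) = it

setInner : ITree → OTree → OTree
setInner it (oleaf _) = oleaf it
setInner it (onode _ l r) = onode it l r

-- Building (fuel argument only for termination; fuel = range size suffices)

buildI : (fuel lo hi : ℕ) → ITree
buildI zero lo hi = ileaf zeroN
buildI (suc f) lo hi =
  if lo <ᵇ hi
  then inode zeroN (buildI f lo (mid lo hi)) (buildI f (suc (mid lo hi)) hi)
  else ileaf zeroN

buildO : (fuel lo hi m : ℕ) → OTree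
buildO zero lo hi m = oleaf (buildI m 1 m)
buildO (suc f) lo hi m =
  if lo <ᵇ hi
  then onode (buildI m 1 m) (buildO f lo (mid lo hi) m) (buildO f (suc (mid lo hi)) hi m)
  else oleaf (buildI m 1 m)

initial : (n m : ℕ) → OTree
initial n m = buildO n 1 n m

-- Space: number of stored scalar fields (4 per inner node)

spaceI : ITree → ℕ
spaceI (ileaf _) = 4
spaceI (inode _ l r) = 4 ℕ.+ (spaceI l ℕ.+ spaceI r)

spaceO : OTree → ℕ
spaceO (oleaf it) = spaceI it
spaceO (onode it l r) = spaceI it ℕ.+ (spaceO l ℕ.+ spaceO r)

space : (n m : ℕ) → ℕ
space n m = spaceO (initial n m)

-- Operations, instrumented with their running time
-- (cost = number of tree nodes visited, outer and inner; each visit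
--  does O(1) work).

updI : Which → (lo hi ys ye : ℕ) → ℚ → ITree → ITree × ℕ
updI w lo hi ys ye v t =
  if disjointᵇ ys ye lo hi then (t , 1)
  else if insideᵇ ys ye lo hi then (covered t , 1)
  else partial t
  where
  covered : ITree → ITree
  covered (ileaf nd) =
    ileaf (setF w (mkF (value (getF w nd) + v * sizeℚ lo hi) (lazy (getF w nd) + v)) nd)
  covered (inode nd l r) =
    inode (setF w (mkF (value (getF w nd) + v * sizeℚ lo hi) (lazy (getF w nd) + v)) nd) l r
  partial : ITree → ITree × ℕ
  partial (ileaf nd) = (ileaf nd , 1)   -- unreachable for well-shaped trees
  partial (inode nd l r) =
    let rl = updI w lo (mid lo hi) ys ye v l
        rr = updI w (suc (mid lo hi)) hi ys ye v r
        l′ = proj₁ rl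
        r′ = proj₁ rr
        nv = value (getF w (rootI l′)) + value (getF w (rootI r′))
               + lazy (getF w nd) * sizeℚ lo hi
    in (inode (setF w (mkF nv (lazy (getF w nd))) nd) l′ r′ ,
        suc (proj₂ rl ℕ.+ proj₂ rr))

-- Inner range query.  `sel` selects the (value , lazy) pair used
-- (global+local for complete queries, global only for partial ones);
-- `s` scales node values at fully covered nodes (1 for complete queries,
-- the outer ratio for partial ones); lazies are multiplied by the size
-- of the trimmed query region.
qI : (INode → Fields) → ℚ → (lo hi ys ye : ℕ) → ITree → ℚ × ℕ
qI sel s lo hi ys ye t =
  if disjointᵇ ys ye lo hi then (0ℚ , 1)
  else if insideᵇ ys ye lo hi then (s * value (sel (rootI t)) , 1)
  else partial t
  where
  partial : ITree → ℚ × ℕ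
  partial (ileaf nd) = (0ℚ , 1)   -- unreachable for well-shaped trees
  partial (inode nd l r) =
    let rl = qI sel s lo (mid lo hi) ys ye l
        rr = qI sel s (suc (mid lo hi)) hi ys ye r
    in (proj₁ rl + proj₁ rr + lazy (sel nd) * toℚ (common ys ye lo hi) ,
        suc (proj₂ rl ℕ.+ proj₂ rr))

globalSel : INode → Fields
globalSel nd = global nd

bothSel : INode → Fields
bothSel nd = mkF (value (global nd) + value (local nd)) (lazy (global nd) + lazy (local nd))

updO : (m lo hi xs xe ys ye : ℕ) → ℚ → OTree → OTree × ℕ
updO m lo hi xs xe ys ye c t =
  if disjointᵇ xs xe lo hi then (t , 1)
  else if insideᵇ xs xe lo hi then
    (let r = updI glob 1 m ys ye c (innerOf t) in (setInner (proj₁ r) t , suc (proj₂ r)))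
  else partial t
  where
  partial : OTree → OTree × ℕ
  partial (oleaf it) = (oleaf it , 1)   -- unreachable for well-shaped trees
  partial (onode it l r) =
    let ri = updI loc 1 m ys ye (c * ratio xs xe lo hi) it
        rl = updO m lo (mid lo hi) xs xe ys ye c l
        rr = updO m (suc (mid lo hi)) hi xs xe ys ye c r
    in (onode (proj₁ ri) (proj₁ rl) (proj₁ rr) ,
        suc (proj₂ ri ℕ.+ (proj₂ rl ℕ.+ proj₂ rr)))

qO : (m lo hi xs xe ys ye : ℕ) → OTree → ℚ × ℕ
qO m lo hi xs xe ys ye t =
  if disjointᵇ xs xe lo hi then (0ℚ , 1)
  else if insideᵇ xs xe lo hi then
    (let r = qI bothSel 1ℚ 1 m ys ye (innerOf t) in (proj₁ r , suc (proj₂ r)))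
  else partial t
  where
  partial : OTree → ℚ × ℕ
  partial (oleaf it) = (0ℚ , 1)   -- unreachable for well-shaped trees
  partial (onode it l r) =
    let ri = qI globalSel (ratio xs xe lo hi) 1 m ys ye it
        rl = qO m lo (mid lo hi) xs xe ys ye l
        rr = qO m (suc (mid lo hi)) hi xs xe ys ye r
    in (proj₁ ri + (proj₁ rl + proj₁ rr) ,
        suc (proj₂ ri ℕ.+ (proj₂ rl ℕ.+ proj₂ rr)))

update : (n m xs xe ys ye : ℕ) → ℚ → OTree → OTree × ℕ
update n m xs xe ys ye c t = updO m 1 n xs xe ys ye c t

query : (n m xs xe ys ye : ℕ) → OTree → ℚ × ℕ
query n m xs xe ys ye t = qO m 1 n xs xe ys ye t

ValidRange : (n m xs xe ys ye : ℕ) → Set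
ValidRange n m xs xe ys ye =
  (1 ℕ.≤ xs) × (xs ℕ.≤ xe) × (xe ℕ.≤ n) × (1 ℕ.≤ ys) × (ys ℕ.≤ ye) × (ye ℕ.≤ m)

data Reachable (n m : ℕ) : OTree → Set where
  init : Reachable n m (initial n m)
  step : ∀ {t} → Reachable n m t → ∀ xs xe ys ye (c : ℚ) →
         ValidRange n m xs xe ys ye →
         Reachable n m (proj₁ (update n m xs xe ys ye c t))

-- A range operation on a segment tree descends only through nodes that partially
-- overlap the range.  Once the descent has split at a midpoint, every node that is
-- still partially overlapped has one of its ends inside the range, and such a node
-- has at most one partially overlapped child.  Hence a tree over w cells (height
-- ⌈log₂ w⌉) has at most 4⌈log₂ w⌉ + 1 visited nodes.  Every visited outer node costs
-- one inner operation, bounded the same way, so the total is at most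
-- (4⌈log₂ n⌉ + 1)(4⌈log₂ m⌉ + 2) ≤ 16(⌈log₂ n⌉ + 1)(⌈log₂ m⌉ + 1).  For space, a
-- tree over w cells has 2w − 1 nodes: each inner tree stores at most 8m fields and
-- there are fewer than 2n of them.

{-# OPTIONS --safe #-}
module Submission where

open import Defs
open import Data.Nat using (ℕ; _+_; _*_; _≤_)
open import Data.Nat.Logarithm using (⌈log₂_⌉)
open import Data.Rational using (ℚ)
open import Data.Product using (Σ; _×_; proj₂)

open import Data.Bool using (true; false; if_then_else_)
open import Data.Bool.Properties using (T-≡; ∨-zeroʳ)
open import Data.Nat using (zero; suc; _<_; _∸_; _<ᵇ_; _≤?_; z≤n; s≤s; ⌊_/2⌋; ⌈_/2⌉)
open import Data.Nat.Properties
open import Data.Nat.Logarithm using (⌈log₂⌉-mono-≤; ⌈log₂⌈n/2⌉⌉≡⌈log₂n⌉∸1)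
open import Data.Nat.Tactic.RingSolver using (solve-∀)
open import Data.Product using (_,_)
open import Function.Base using (case_of_)
open import Function.Bundles using (Equivalence)
open import Relation.Binary.PropositionalEquality
open import Relation.Nullary using (yes; no; contradiction)

width : ℕ → ℕ → ℕ
width lo hi = suc hi ∸ lo

height : ℕ → ℕ → ℕ
height lo hi = ⌈log₂ width lo hi ⌉

width-offset : ∀ lo k → width lo (lo + k) ≡ suc k
width-offset lo k = trans (cong (_∸ lo) (sym (+-suc lo k))) (m+n∸m≡n lo (suc k))

mid-offset : ∀ lo k → mid lo (lo + k) ≡ lo + ⌊ k /2⌋
mid-offset zero k = refl
mid-offset (suc lo) k rewrite +-suc lo (lo + k) = cong suc (mid-offset lo k)

lo≤mid : ∀ {lo hi} → lo ≤ hi → lo ≤ mid lo hi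
lo≤mid {lo} lo≤hi with m≤n⇒∃[o]m+o≡n lo≤hi
... | k , refl rewrite mid-offset lo k = m≤m+n lo ⌊ k /2⌋

mid<hi : ∀ {lo hi} → lo < hi → mid lo hi < hi
mid<hi {lo} lo<hi with m≤n⇒∃[o]m+o≡n lo<hi
... | k , refl rewrite sym (+-suc lo k) | mid-offset lo (suc k) = +-monoʳ-< lo (⌊n/2⌋<n k)

width-left : ∀ {lo hi} → lo ≤ hi → width lo (mid lo hi) ≡ ⌈ width lo hi /2⌉
width-left {lo} lo≤hi with m≤n⇒∃[o]m+o≡n lo≤hi
... | k , refl rewrite mid-offset lo k | width-offset lo ⌊ k /2⌋ | width-offset lo k = refl

width-right : ∀ {lo hi} → lo ≤ hi → width (suc (mid lo hi)) hi ≡ ⌊ width lo hi /2⌋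
width-right {lo} lo≤hi with m≤n⇒∃[o]m+o≡n lo≤hi
... | k , refl rewrite mid-offset lo k | width-offset lo k = begin
  lo + k ∸ (lo + ⌊ k /2⌋)      ≡⟨ [m+n]∸[m+o]≡n∸o lo k ⌊ k /2⌋ ⟩
  k ∸ ⌊ k /2⌋                  ≡⟨ cong (_∸ ⌊ k /2⌋) (sym (⌊n/2⌋+⌈n/2⌉≡n k)) ⟩
  ⌊ k /2⌋ + ⌈ k /2⌉ ∸ ⌊ k /2⌋  ≡⟨ m+n∸m≡n ⌊ k /2⌋ ⌈ k /2⌉ ⟩
  ⌈ k /2⌉                      ∎
  where open ≡-Reasoning

width-halves : ∀ {lo hi} → lo ≤ hi → width lo (mid lo hi) + width (suc (mid lo hi)) hi ≡ width lo hi
width-halves {lo} {hi} lo≤hi = begin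
  width lo (mid lo hi) + width (suc (mid lo hi)) hi  ≡⟨ cong₂ _+_ (width-left lo≤hi) (width-right lo≤hi) ⟩
  ⌈ width lo hi /2⌉ + ⌊ width lo hi /2⌋               ≡⟨ +-comm _ ⌊ width lo hi /2⌋ ⟩
  ⌊ width lo hi /2⌋ + ⌈ width lo hi /2⌉               ≡⟨ ⌊n/2⌋+⌈n/2⌉≡n (width lo hi) ⟩
  width lo hi                                         ∎
  where open ≡-Reasoning

0<width : ∀ {lo hi} → lo ≤ hi → 0 < width lo hi
0<width lo≤hi = m<n⇒0<n∸m (s≤s lo≤hi)

0<height : ∀ {lo hi} → lo < hi → 0 < height lo hi
0<height {lo} lo<hi =
  ⌈log₂⌉-mono-≤ (≤-trans (≤-reflexive (sym (m+n∸n≡m 2 lo))) (∸-monoˡ-≤ lo (s≤s lo<hi)))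

⌈log₂⌈n/2⌉⌉≤ : ∀ n {ℓ} → ⌈log₂ n ⌉ ≤ suc ℓ → ⌈log₂ ⌈ n /2⌉ ⌉ ≤ ℓ
⌈log₂⌈n/2⌉⌉≤ n h = ≤-trans (≤-reflexive (⌈log₂⌈n/2⌉⌉≡⌈log₂n⌉∸1 n)) (∸-monoˡ-≤ 1 h)

height-left : ∀ {lo hi ℓ} → lo ≤ hi → height lo hi ≤ suc ℓ → height lo (mid lo hi) ≤ ℓ
height-left {lo} {hi} lo≤hi h =
  subst (λ w → ⌈log₂ w ⌉ ≤ _) (sym (width-left lo≤hi)) (⌈log₂⌈n/2⌉⌉≤ (width lo hi) h)

height-right : ∀ {lo hi ℓ} → lo ≤ hi → height lo hi ≤ suc ℓ → height (suc (mid lo hi)) hi ≤ ℓ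
height-right {lo} {hi} {ℓ} lo≤hi h = begin
  height (suc (mid lo hi)) hi  ≡⟨ cong ⌈log₂_⌉ (width-right lo≤hi) ⟩
  ⌈log₂ ⌊ width lo hi /2⌋ ⌉     ≤⟨ ⌈log₂⌉-mono-≤ (⌊n/2⌋≤⌈n/2⌉ (width lo hi)) ⟩
  ⌈log₂ ⌈ width lo hi /2⌉ ⌉     ≤⟨ ⌈log₂⌈n/2⌉⌉≤ (width lo hi) h ⟩
  ℓ                            ∎
  where open ≤-Reasoning

module _ {a b lo hi : ℕ} where

  insideᵇ-true : a ≤ lo → hi ≤ b → insideᵇ a b lo hi ≡ true
  insideᵇ-true a≤lo hi≤b
    rewrite Equivalence.to T-≡ (≤⇒≤ᵇ a≤lo) | Equivalence.to T-≡ (≤⇒≤ᵇ hi≤b) = refl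

  disjointᵇ-trueˡ : b < lo → disjointᵇ a b lo hi ≡ true
  disjointᵇ-trueˡ b<lo rewrite Equivalence.to T-≡ (<⇒<ᵇ b<lo) = refl

  disjointᵇ-trueʳ : hi < a → disjointᵇ a b lo hi ≡ true
  disjointᵇ-trueʳ hi<a rewrite Equivalence.to T-≡ (<⇒<ᵇ hi<a) = ∨-zeroʳ (b <ᵇ lo)

  partial⇒lo<hi : disjointᵇ a b lo hi ≡ false → insideᵇ a b lo hi ≡ false → lo < hi
  partial⇒lo<hi d i = ≰⇒> λ hi≤lo →
    contradiction (trans (sym i) (insideᵇ-true (≤-trans a≤hi hi≤lo) (≤-trans hi≤lo lo≤b))) λ ()
    where
    lo≤b : lo ≤ b
    lo≤b = ≮⇒≥ λ b<lo → contradiction (trans (sym d) (disjointᵇ-trueˡ b<lo)) λ ()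
    a≤hi : a ≤ hi
    a≤hi = ≮⇒≥ λ hi<a → contradiction (trans (sym d) (disjointᵇ-trueʳ hi<a)) λ ()

skip+recurse≤ : ∀ {x y} k ℓ → 2 ≤ k → x ≤ 1 → y ≤ suc (k * ℓ) → x + y ≤ k * suc ℓ
skip+recurse≤ {x} {y} k ℓ 2≤k x≤1 y≤ = begin
  x + y        ≤⟨ +-mono-≤ x≤1 y≤ ⟩
  2 + k * ℓ    ≤⟨ +-monoˡ-≤ (k * ℓ) 2≤k ⟩
  k + k * ℓ    ≡⟨ *-suc k ℓ ⟨
  k * suc ℓ    ∎
  where open ≤-Reasoning

recurse+skip≤ : ∀ {x y} k ℓ → 2 ≤ k → x ≤ suc (k * ℓ) → y ≤ 1 → x + y ≤ k * suc ℓ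
recurse+skip≤ {x} {y} k ℓ 2≤k x≤ y≤1 =
  subst (_≤ k * suc ℓ) (+-comm y x) (skip+recurse≤ k ℓ 2≤k y≤1 x≤)

recurse+recurse≤ : ∀ {x y} ℓ → x ≤ suc (2 * ℓ) → y ≤ suc (2 * ℓ) → x + y ≤ 4 * suc ℓ
recurse+recurse≤ {x} {y} ℓ x≤ y≤ = begin
  x + y                          ≤⟨ +-mono-≤ x≤ y≤ ⟩
  suc (2 * ℓ) + suc (2 * ℓ)      ≤⟨ m≤m+n _ 2 ⟩
  suc (2 * ℓ) + suc (2 * ℓ) + 2  ≡⟨ lemma ℓ ⟩
  4 * suc ℓ                      ∎
  where
  open ≤-Reasoning
  lemma : ∀ ℓ → suc (2 * ℓ) + suc (2 * ℓ) + 2 ≡ 4 * suc ℓ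
  lemma = solve-∀

-- Running times depend only on the shape of a tree, not on the stored fields.
data Shape : Set where
  tip : Shape
  bin : Shape → Shape → Shape

shapeI : ITree → Shape
shapeI (ileaf _)     = tip
shapeI (inode _ l r) = bin (shapeI l) (shapeI r)

shapeO : OTree → Shape
shapeO (oleaf _)     = tip
shapeO (onode _ l r) = bin (shapeO l) (shapeO r)

visits : (lo hi a b : ℕ) → Shape → ℕ
visits lo hi a b tip       = 1
visits lo hi a b (bin l r) =
  if disjointᵇ a b lo hi then 1 else if insideᵇ a b lo hi then 1
  else suc (visits lo (mid lo hi) a b l + visits (suc (mid lo hi)) hi a b r)

module _ {a b : ℕ} where

  visits-disjointˡ : ∀ {lo hi} t → b < lo → visits lo hi a b t ≡ 1
  visits-disjointˡ           tip       _    = refl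
  visits-disjointˡ {lo} {hi} (bin _ _) b<lo rewrite disjointᵇ-trueˡ {a} {b} {lo} {hi} b<lo = refl

  visits-disjointʳ : ∀ {lo hi} t → hi < a → visits lo hi a b t ≡ 1
  visits-disjointʳ           tip       _    = refl
  visits-disjointʳ {lo} {hi} (bin _ _) hi<a rewrite disjointᵇ-trueʳ {a} {b} {lo} {hi} hi<a = refl

  visits-inside : ∀ {lo hi} t → a ≤ lo → hi ≤ b → visits lo hi a b t ≡ 1
  visits-inside           tip       _    _    = refl
  visits-inside {lo} {hi} (bin _ _) a≤lo hi≤b with disjointᵇ a b lo hi
  ... | true  = refl
  ... | false rewrite insideᵇ-true {a} {b} {lo} {hi} a≤lo hi≤b = refl

  visits-bin≤ : ∀ {lo hi k} l r →
    (lo < hi → visits lo (mid lo hi) a b l + visits (suc (mid lo hi)) hi a b r ≤ k) →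
    visits lo hi a b (bin l r) ≤ suc k
  visits-bin≤ {lo} {hi} l r partial with disjointᵇ a b lo hi in d | insideᵇ a b lo hi in i
  ... | true  | _     = s≤s z≤n
  ... | false | true  = s≤s z≤n
  ... | false | false = s≤s (partial (partial⇒lo<hi {a} {b} d i))

  visits-flat : ∀ {lo hi} t → height lo hi ≤ 0 → visits lo hi a b t ≤ 1
  visits-flat tip       _ = ≤-refl
  visits-flat {lo} {hi} (bin l r) h =
    visits-bin≤ {lo} {hi} l r λ lo<hi → contradiction (0<height lo<hi) (≤⇒≯ h)

  visits≤-prefix : ∀ ℓ {lo hi} t → a ≤ lo → height lo hi ≤ ℓ → visits lo hi a b t ≤ suc (2 * ℓ)
  visits≤-prefix zero    t         _    h = visits-flat t h
  visits≤-prefix (suc ℓ) tip       _    _ = s≤s z≤n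
  visits≤-prefix (suc ℓ) {lo} {hi} (bin l r) a≤lo h = visits-bin≤ {lo} {hi} l r λ lo<hi →
    let lo≤hi = <⇒≤ lo<hi in
    case mid lo hi ≤? b of λ where
      (yes mid≤b) → skip+recurse≤ 2 ℓ ≤-refl
        (≤-reflexive (visits-inside l a≤lo mid≤b))
        (visits≤-prefix ℓ r (≤-trans a≤lo (m≤n⇒m≤1+n (lo≤mid lo≤hi))) (height-right lo≤hi h))
      (no mid≰b)  → recurse+skip≤ 2 ℓ ≤-refl
        (visits≤-prefix ℓ l a≤lo (height-left lo≤hi h))
        (≤-reflexive (visits-disjointˡ r (m≤n⇒m≤1+n (≰⇒> mid≰b))))

  visits≤-suffix : ∀ ℓ {lo hi} t → hi ≤ b → height lo hi ≤ ℓ → visits lo hi a b t ≤ suc (2 * ℓ)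
  visits≤-suffix zero    t         _    h = visits-flat t h
  visits≤-suffix (suc ℓ) tip       _    _ = s≤s z≤n
  visits≤-suffix (suc ℓ) {lo} {hi} (bin l r) hi≤b h = visits-bin≤ {lo} {hi} l r λ lo<hi →
    let lo≤hi = <⇒≤ lo<hi in
    case a ≤? mid lo hi of λ where
      (yes a≤mid) → recurse+skip≤ 2 ℓ ≤-refl
        (visits≤-suffix ℓ l (≤-trans (<⇒≤ (mid<hi lo<hi)) hi≤b) (height-left lo≤hi h))
        (≤-reflexive (visits-inside r (m≤n⇒m≤1+n a≤mid) hi≤b))
      (no a≰mid)  → skip+recurse≤ 2 ℓ ≤-refl
        (≤-reflexive (visits-disjointʳ l (≰⇒> a≰mid)))
        (visits≤-suffix ℓ r hi≤b (height-right lo≤hi h))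

  visits≤ : ∀ ℓ {lo hi} t → height lo hi ≤ ℓ → visits lo hi a b t ≤ suc (4 * ℓ)
  visits≤ zero    t         h = visits-flat t h
  visits≤ (suc ℓ) tip       _ = s≤s z≤n
  visits≤ (suc ℓ) {lo} {hi} (bin l r) h = visits-bin≤ {lo} {hi} l r λ lo<hi →
    let lo≤hi = <⇒≤ lo<hi in
    case b ≤? mid lo hi of λ where
      (yes b≤mid) → recurse+skip≤ 4 ℓ 2≤4
        (visits≤ ℓ l (height-left lo≤hi h))
        (≤-reflexive (visits-disjointˡ r (s≤s b≤mid)))
      (no b≰mid)  → case a ≤? mid lo hi of λ where
        (yes a≤mid) → recurse+recurse≤ ℓ
          (visits≤-suffix ℓ l (<⇒≤ (≰⇒> b≰mid)) (height-left lo≤hi h))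
          (visits≤-prefix ℓ r (m≤n⇒m≤1+n a≤mid) (height-right lo≤hi h))
        (no a≰mid)  → skip+recurse≤ 4 ℓ 2≤4
          (≤-reflexive (visits-disjointʳ l (≰⇒> a≰mid)))
          (visits≤ ℓ r (height-right lo≤hi h))
    where
    2≤4 : 2 ≤ 4
    2≤4 = s≤s (s≤s z≤n)

updI-cost : ∀ w lo hi ys ye v t → proj₂ (updI w lo hi ys ye v t) ≡ visits lo hi ys ye (shapeI t)
updI-cost w lo hi ys ye v (ileaf _) with disjointᵇ ys ye lo hi | insideᵇ ys ye lo hi
... | true  | _     = refl
... | false | true  = refl
... | false | false = refl
updI-cost w lo hi ys ye v (inode _ l r) with disjointᵇ ys ye lo hi | insideᵇ ys ye lo hi
... | true  | _     = refl
... | false | true  = refl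
... | false | false = cong suc (cong₂ _+_ (updI-cost w lo (mid lo hi) ys ye v l)
                                          (updI-cost w (suc (mid lo hi)) hi ys ye v r))

qI-cost : ∀ sel s lo hi ys ye t → proj₂ (qI sel s lo hi ys ye t) ≡ visits lo hi ys ye (shapeI t)
qI-cost sel s lo hi ys ye (ileaf _) with disjointᵇ ys ye lo hi | insideᵇ ys ye lo hi
... | true  | _     = refl
... | false | true  = refl
... | false | false = refl
qI-cost sel s lo hi ys ye (inode _ l r) with disjointᵇ ys ye lo hi | insideᵇ ys ye lo hi
... | true  | _     = refl
... | false | true  = refl
... | false | false = cong suc (cong₂ _+_ (qI-cost sel s lo (mid lo hi) ys ye l)
                                          (qI-cost sel s (suc (mid lo hi)) hi ys ye r))

outer-node≤ : ∀ {i x y u v} K → i ≤ K → x ≤ suc K * u → y ≤ suc K * v →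
              suc (i + (x + y)) ≤ suc K * suc (u + v)
outer-node≤ {i} {x} {y} {u} {v} K i≤ x≤ y≤ = begin
  suc (i + (x + y))                   ≤⟨ s≤s (+-mono-≤ i≤ (+-mono-≤ x≤ y≤)) ⟩
  suc (K + (suc K * u + suc K * v))   ≡⟨ cong (λ z → suc (K + z)) (*-distribˡ-+ (suc K) u v) ⟨
  suc K + suc K * (u + v)             ≡⟨ *-suc (suc K) (u + v) ⟨
  suc K * suc (u + v)                 ∎
  where open ≤-Reasoning

module _ (m ys ye : ℕ) {K : ℕ} (inner≤ : ∀ it → visits 1 m ys ye (shapeI it) ≤ K) where

  private
    outer-inside≤ : ∀ {c} it → c ≡ visits 1 m ys ye (shapeI it) → suc c ≤ suc K * 1
    outer-inside≤ {c} it c≡ = s≤s (begin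
      c                            ≡⟨ c≡ ⟩
      visits 1 m ys ye (shapeI it)  ≤⟨ inner≤ it ⟩
      K                            ≡⟨ *-identityʳ K ⟨
      K * 1                        ∎)
      where open ≤-Reasoning

  updO-cost≤ : ∀ lo hi xs xe c t →
    proj₂ (updO m lo hi xs xe ys ye c t) ≤ suc K * visits lo hi xs xe (shapeO t)
  updO-cost≤ lo hi xs xe c (oleaf it) with disjointᵇ xs xe lo hi | insideᵇ xs xe lo hi
  ... | true  | _     = s≤s z≤n
  ... | false | true  = outer-inside≤ it (updI-cost glob 1 m ys ye c it)
  ... | false | false = s≤s z≤n
  updO-cost≤ lo hi xs xe c (onode it l r) with disjointᵇ xs xe lo hi | insideᵇ xs xe lo hi
  ... | true  | _     = s≤s z≤n
  ... | false | true  = outer-inside≤ it (updI-cost glob 1 m ys ye c it)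
  ... | false | false = outer-node≤ K
    (≤-trans (≤-reflexive (updI-cost loc 1 m ys ye _ it)) (inner≤ it))
    (updO-cost≤ lo (mid lo hi) xs xe c l) (updO-cost≤ (suc (mid lo hi)) hi xs xe c r)

  qO-cost≤ : ∀ lo hi xs xe t →
    proj₂ (qO m lo hi xs xe ys ye t) ≤ suc K * visits lo hi xs xe (shapeO t)
  qO-cost≤ lo hi xs xe (oleaf it) with disjointᵇ xs xe lo hi | insideᵇ xs xe lo hi
  ... | true  | _     = s≤s z≤n
  ... | false | true  = outer-inside≤ it (qI-cost bothSel _ 1 m ys ye it)
  ... | false | false = s≤s z≤n
  qO-cost≤ lo hi xs xe (onode it l r) with disjointᵇ xs xe lo hi | insideᵇ xs xe lo hi
  ... | true  | _     = s≤s z≤n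
  ... | false | true  = outer-inside≤ it (qI-cost bothSel _ 1 m ys ye it)
  ... | false | false = outer-node≤ K
    (≤-trans (≤-reflexive (qI-cost globalSel _ 1 m ys ye it)) (inner≤ it))
    (qO-cost≤ lo (mid lo hi) xs xe l) (qO-cost≤ (suc (mid lo hi)) hi xs xe r)

log-product-bound : ∀ a b → suc (suc (4 * b)) * suc (4 * a) ≤ 16 * ((a + 1) * (b + 1))
log-product-bound a b = ≤-trans (m≤m+n _ (8 * a + 12 * b + 14)) (≤-reflexive (lemma a b))
  where
  lemma : ∀ a b → suc (suc (4 * b)) * suc (4 * a) + (8 * a + 12 * b + 14) ≡ 16 * ((a + 1) * (b + 1))
  lemma = solve-∀

inner-visits≤ : ∀ {m ys ye} it → visits 1 m ys ye (shapeI it) ≤ suc (4 * ⌈log₂ m ⌉)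
inner-visits≤ {m} it = visits≤ ⌈log₂ m ⌉ (shapeI it) ≤-refl

outer-visits≤ : ∀ n m xs xe t →
  suc (suc (4 * ⌈log₂ m ⌉)) * visits 1 n xs xe (shapeO t) ≤ 16 * ((⌈log₂ n ⌉ + 1) * (⌈log₂ m ⌉ + 1))
outer-visits≤ n m xs xe t =
  ≤-trans (*-monoʳ-≤ (suc (suc (4 * ⌈log₂ m ⌉))) (visits≤ ⌈log₂ n ⌉ (shapeO t) ≤-refl))
          (log-product-bound ⌈log₂ n ⌉ ⌈log₂ m ⌉)

update-cost≤ : ∀ n m xs xe ys ye c t →
  proj₂ (update n m xs xe ys ye c t) ≤ 16 * ((⌈log₂ n ⌉ + 1) * (⌈log₂ m ⌉ + 1))
update-cost≤ n m xs xe ys ye c t =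
  ≤-trans (updO-cost≤ m ys ye inner-visits≤ 1 n xs xe c t) (outer-visits≤ n m xs xe t)

query-cost≤ : ∀ n m xs xe ys ye t →
  proj₂ (query n m xs xe ys ye t) ≤ 16 * ((⌈log₂ n ⌉ + 1) * (⌈log₂ m ⌉ + 1))
query-cost≤ n m xs xe ys ye t =
  ≤-trans (qO-cost≤ m ys ye inner-visits≤ 1 n xs xe t) (outer-visits≤ n m xs xe t)

space-leaf≤ : ∀ {i w} S → i ≤ S → 0 < w → i + S ≤ 2 * S * w
space-leaf≤ {i} {w} S i≤S 0<w = begin
  i + S        ≤⟨ +-monoˡ-≤ S i≤S ⟩
  S + S        ≡⟨ lemma S ⟩
  2 * S * 1    ≤⟨ *-monoʳ-≤ (2 * S) 0<w ⟩
  2 * S * w    ∎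
  where
  open ≤-Reasoning
  lemma : ∀ S → S + S ≡ 2 * S * 1
  lemma = solve-∀

space-node≤ : ∀ {i x y} S {wl wr w} → wl + wr ≡ w →
              i ≤ S → x + S ≤ 2 * S * wl → y + S ≤ 2 * S * wr → i + (x + y) + S ≤ 2 * S * w
space-node≤ {i} {x} {y} S {wl} {wr} {w} refl i≤S x≤ y≤ = begin
  i + (x + y) + S              ≤⟨ +-monoˡ-≤ S (+-monoˡ-≤ (x + y) i≤S) ⟩
  S + (x + y) + S              ≡⟨ lemma S x y ⟩
  (x + S) + (y + S)            ≤⟨ +-mono-≤ x≤ y≤ ⟩
  2 * S * wl + 2 * S * wr      ≡⟨ *-distribˡ-+ (2 * S) wl wr ⟨
  2 * S * (wl + wr)            ∎
  where
  open ≤-Reasoning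
  lemma : ∀ S x y → S + (x + y) + S ≡ (x + S) + (y + S)
  lemma = solve-∀

spaceI-buildI≤ : ∀ f {lo hi} → lo ≤ hi → spaceI (buildI f lo hi) + 4 ≤ 8 * width lo hi
spaceI-buildI≤ zero    lo≤hi = space-leaf≤ 4 ≤-refl (0<width lo≤hi)
spaceI-buildI≤ (suc f) {lo} {hi} lo≤hi with lo <ᵇ hi in lo<ᵇhi
... | false = space-leaf≤ 4 ≤-refl (0<width lo≤hi)
... | true  = space-node≤ 4 {width lo (mid lo hi)} {width (suc (mid lo hi)) hi} (width-halves lo≤hi)
  ≤-refl (spaceI-buildI≤ f (lo≤mid lo≤hi)) (spaceI-buildI≤ f (mid<hi lo<hi))
  where
  lo<hi : lo < hi
  lo<hi = <ᵇ⇒< lo hi (Equivalence.from T-≡ lo<ᵇhi)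

module _ {m S : ℕ} (inner≤S : spaceI (buildI m 1 m) ≤ S) where

  spaceO-buildO≤ : ∀ f {lo hi} → lo ≤ hi → spaceO (buildO f lo hi m) + S ≤ 2 * S * width lo hi
  spaceO-buildO≤ zero    lo≤hi = space-leaf≤ S inner≤S (0<width lo≤hi)
  spaceO-buildO≤ (suc f) {lo} {hi} lo≤hi with lo <ᵇ hi in lo<ᵇhi
  ... | false = space-leaf≤ S inner≤S (0<width lo≤hi)
  ... | true  = space-node≤ S (width-halves lo≤hi) inner≤S
    (spaceO-buildO≤ f (lo≤mid lo≤hi)) (spaceO-buildO≤ f (mid<hi lo<hi))
    where
    lo<hi : lo < hi
    lo<hi = <ᵇ⇒< lo hi (Equivalence.from T-≡ lo<ᵇhi)

space≤ : ∀ {n m} → 1 ≤ n → 1 ≤ m → space n m ≤ 16 * (n * m)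
space≤ {n} {m} 1≤n 1≤m = begin
  space n m                     ≤⟨ m≤m+n (space n m) (8 * m) ⟩
  space n m + 8 * m             ≤⟨ spaceO-buildO≤ inner≤8m n 1≤n ⟩
  2 * (8 * m) * n               ≡⟨ lemma n m ⟩
  16 * (n * m)                  ∎
  where
  open ≤-Reasoning
  inner≤8m : spaceI (buildI m 1 m) ≤ 8 * m
  inner≤8m = m+n≤o⇒m≤o _ (spaceI-buildI≤ m 1≤m)
  lemma : ∀ n m → 2 * (8 * m) * n ≡ 16 * (n * m)
  lemma = solve-∀

-- The cost bounds hold for every tree and every pair of ranges, reachable and valid or not.
mainTheorem2 : Σ ℕ λ C → ∀ (n m : ℕ) → 1 ≤ m → m ≤ n →
    (space n m ≤ C * (n * m))
    × (∀ (t : OTree) → Reachable n m t → ∀ (xs xe ys ye : ℕ) → ValidRange n m xs xe ys ye →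
        (∀ (c : ℚ) → proj₂ (update n m xs xe ys ye c t) ≤ C * ((⌈log₂ n ⌉ + 1) * (⌈log₂ m ⌉ + 1)))
        × (proj₂ (query n m xs xe ys ye t) ≤ C * ((⌈log₂ n ⌉ + 1) * (⌈log₂ m ⌉ + 1))))
mainTheorem2 = 16 , λ n m 1≤m m≤n →
  space≤ (≤-trans 1≤m m≤n) 1≤m ,
  λ t _ xs xe ys ye _ → (λ c → update-cost≤ n m xs xe ys ye c t) , query-cost≤ n m xs xe ys ye t
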